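{- For weak compositions $a$ and $b$ of length $n$, $$\mathfrak{M}_a\,\mathfrak{M}_b=\sum_c N_c\,\mathfrak{M}_c,$$ where $c$ ranges over weak compositions of length $n$ and $N_c$ is the number of pairs $(\gamma_a,\gamma_b)\in\mathrm{QSS}(a,b)$ with $\mathrm{bump}_{(a,b)}(\gamma_a,\gamma_b)=c$ (i.e. $N_c$ is the coefficient of $c$ in the quasi-slide product $a\uplus b$).
   Context: Weak compositions of length $n$ are sequences of $n$ nonnegative integers; $\mathrm{flat}(a)$ deletes zero entries; $b\ge a$ (dominance) means $b_1+\dots+b_i\ge a_1+\dots+a_i$ for all $i$. Monomial slide polynomial: $\mathfrak{M}_a=\sum x_1^{d_1}\cdots x_n^{d_n}$ over weak compositions $d$ of length $n$ with $d\ge a$ and $\mathrm{flat}(d)=\mathrm{flat}(a)$. If $c$ is a weak composition of length $n$ and $\gamma$ is a sequence with as many entries as $c$ has nonzero entries, write $c[\gamma]$ for the weak composition of length $n$ obtained by placing the entries of $\gamma$, in order, at the positions of the nonzero entries of $c$ and $0$ elsewhere. Quasi-shuffle set: $\mathrm{QSS}(a,b)$ is the set of pairs $(\gamma_a,\gamma_b)$ of weak compositions of a common length $\ell$ such that $\mathrm{flat}(\gamma_a)=\mathrm{flat}(a)$, $\mathrm{flat}(\gamma_b)=\mathrm{flat}(b)$, $(\gamma_a+\gamma_b)_i>0$ for all $i\le\ell$, and there exists a weak composition $c$ of length $n$ with $\mathrm{flat}(c)=\gamma_a+\gamma_b$, $c[\gamma_a]\ge a$ and $c[\gamma_b]\ge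 b$. For such a pair, $\mathrm{bump}_{(a,b)}(\gamma_a,\gamma_b)$ is the unique such $c$ which is dominated by all others (i.e. $d\ge c$ for every weak composition $d$ of length $n$ with $\mathrm{flat}(d)=\gamma_a+\gamma_b$, $d[\gamma_a]\ge a$, $d[\gamma_b]\ge b$). The quasi-slide product is the formal sum $a\uplus b=\sum_{(\gamma_a,\gamma_b)\in\mathrm{QSS}(a,b)}\mathrm{bump}_{(a,b)}(\gamma_a,\gamma_b)$. -}

module Defs where

open import Data.Nat using (ℕ; zero; suc; _+_; _≤_; _<_; _≟_; _≤?_; _<?_)
open import Data.List using (List; []; _∷_; filter; concatMap; map; upTo; length; zipWith)
open import Data.Nat.ListAction using (sum)
open import Data.Unit using (⊤; tt)
open import Relation.Nullary using (yes)
import Data.List.Properties as LP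
open import Data.Vec using (Vec; []; _∷_; toList)
import Data.Vec as V
open import Data.Product using (Σ; _×_; _,_)
open import Relation.Nullary using (Dec; ¬?)
open import Relation.Nullary.Decidable using (_×-dec_)
open import Relation.Binary.PropositionalEquality using (_≡_)
open import Data.List.Relation.Binary.Pointwise using (Pointwise)
import Data.List.Relation.Binary.Pointwise as PW
open import Data.List.Relation.Unary.All using (All; all?)
open import Data.List.Relation.Unary.Any using (Any; any?)

WC : ℕ → Set
WC n = Vec ℕ n

flatL : List ℕ → List ℕ
flatL = filter (λ x → ¬? (x ≟ 0))

flat : ∀ {n} → WC n → List ℕ
flat d = flatL (toList d)

_≟L_ : (xs ys : List ℕ) → Dec (xs ≡ ys)
_≟L_ = LP.≡-dec _≟_

psums : List ℕ → List ℕ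
psums = go 0
  where
  go : ℕ → List ℕ → List ℕ
  go s []       = []
  go s (x ∷ xs) = (s + x) ∷ go (s + x) xs

_⊵_ : ∀ {n} → WC n → WC n → Set
b ⊵ a = Pointwise _≤_ (psums (toList a)) (psums (toList b))

_⊵?_ : ∀ {n} (b a : WC n) → Dec (b ⊵ a)
b ⊵? a = PW.decidable _≤?_ (psums (toList a)) (psums (toList b))

allVecs : (n k : ℕ) → List (Vec ℕ n)
allVecs zero    k = [] ∷ []
allVecs (suc n) k = concatMap (λ x → map (x ∷_) (allVecs n k)) (upTo (suc k))

-- All weak compositions d of length n with flat(d) = L.
-- (Every entry of such a d is ≤ sum L, so the enumeration is complete.)
withFlat : (n : ℕ) → List ℕ → List (WC n)
withFlat n L = filter (λ d → flat d ≟L L) (allVecs n (sum L))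

-- Monomial slide polynomial 𝔐_a, as the (finite) multiset of exponent
-- vectors d of its monomials x^d (all coefficients are 1).
slide : ∀ {n} → WC n → List (WC n)
slide {n} a = filter (λ d → d ⊵? a) (withFlat n (flat a))

_+v_ : ∀ {n} → WC n → WC n → WC n
_+v_ = V.zipWith _+_

slideProduct : ∀ {n} → WC n → WC n → List (WC n)
slideProduct a b = concatMap (λ d → map (d +v_) (slide b)) (slide a)

fill : ∀ {n} → WC n → List ℕ → WC n
fill []            γ        = []
fill (zero  ∷ c)   γ        = 0 ∷ fill c γ
fill (suc _ ∷ c)   []       = 0 ∷ fill c []
fill (suc _ ∷ c)   (g ∷ γ)  = g ∷ fill c γ

candidates : ∀ {n} (a b : WC n) {ℓ} → WC ℓ → WC ℓ → List (WC n)
candidates {n} a b γa γb =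
  filter (λ c → (fill c (toList γa) ⊵? a) ×-dec (fill c (toList γb) ⊵? b))
         (withFlat n (toList (γa +v γb)))

-- Candidates c that are dominated by all candidates: the bump (at most one
-- element by antisymmetry of dominance).
bumps : ∀ {n} (a b : WC n) {ℓ} → WC ℓ → WC ℓ → List (WC n)
bumps a b γa γb =
  let cs = candidates a b γa γb in
  filter (λ c → all? (λ d → d ⊵? c) cs) cs

QSSElem : Set
QSSElem = Σ ℕ λ ℓ → WC ℓ × WC ℓ

inQSS? : ∀ {n} (a b : WC n) {ℓ} (γa γb : WC ℓ) → Dec
  ((flat γa ≡ flat a) × (flat γb ≡ flat b) ×
   All (0 <_) (toList (γa +v γb)) × Any (λ _ → ⊤) (candidates a b γa γb))
inQSS? a b γa γb =
  (flat γa ≟L flat a) ×-dec (flat γb ≟L flat b) ×-dec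
  all? (0 <?_) (toList (γa +v γb)) ×-dec any? (λ _ → yes tt) (candidates a b γa γb)

-- Enumeration of QSS(a,b).  Only lengths ℓ ≤ #nonzero(a) + #nonzero(b) can
-- occur (every position of γa+γb is positive), so this list is all of QSS(a,b).
QSS : ∀ {n} → WC n → WC n → List QSSElem
QSS a b = concatMap byLength (upTo (suc (length (flat a) + length (flat b))))
  where
  byLength : ℕ → List QSSElem
  byLength ℓ = concatMap (λ γa → concatMap (λ γb →
                 filter (λ _ → inQSS? a b γa γb) ((ℓ , γa , γb) ∷ []))
               (withFlat ℓ (flat b))) (withFlat ℓ (flat a))

quasiSlide : ∀ {n} → WC n → WC n → List (WC n)
quasiSlide a b = concatMap (λ { (ℓ , γa , γb) → bumps a b γa γb }) (QSS a b)

slideSum : ∀ {n} → List (WC n) → List (WC n)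
slideSum cs = concatMap slide cs

-- Write each monomial of 𝔐_a 𝔐_b as x^(d + e) and read the pair (d, e) off along the support
-- of c = d + e: the restrictions (γa, γb) of d and e to that support form a quasi-shuffle
-- with c[γa] = d ≥ a and c[γb] = e ≥ b.  This is a bijection between the monomials of the
-- product and the pairs ((γa, γb), c) with (γa, γb) ∈ QSS(a, b) and c a candidate for it.
-- For fixed (γa, γb), encode each composition with flattening γa + γb by the number of its
-- nonzero entries up to each position: dominance becomes the pointwise order on these counts,
-- and c ↦ c[γ] is monotone for it.  So the candidates are upward closed and closed under
-- pointwise minima; they are therefore exactly the monomials of 𝔐 at their least element,
-- which is the bump.
module Submission where

open import Defs
open import Data.Nat using (ℕ; zero; suc; _+_; _∸_; _⊓_; _≤_; _<_; _≟_; _≤?_; z≤n; s≤s)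
open import Data.Nat.Properties
open import Data.Nat.ListAction using (sum)
open import Data.List using (List; []; _∷_; _++_; map; filter; concatMap; take; drop; upTo; length; zipWith)
import Data.List.Properties as List
open import Data.List.Membership.Propositional using (_∈_; find; lose)
open import Data.List.Membership.Propositional.Properties
  using (∈-concatMap⁺; ∈-concatMap⁻; ∈-map⁺; ∈-map⁻; ∈-filter⁺; ∈-filter⁻; ∈-upTo⁺)
open import Data.List.Membership.Propositional.Properties.WithK using (unique∧set⇒bag)
open import Data.List.Relation.Unary.All as All using (All; []; _∷_)
import Data.List.Relation.Unary.All.Properties as All
open import Data.List.Relation.Unary.Any using (Any; here; there)
open import Data.List.Relation.Unary.AllPairs using ([]; _∷_)
open import Data.List.Relation.Unary.Unique.Propositional using (Unique)
import Data.List.Relation.Unary.Unique.Propositional.Properties as Unique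
open import Data.List.Relation.Binary.Pointwise as Pointwise using (Pointwise; []; _∷_)
open import Data.List.Relation.Binary.Permutation.Propositional using (_↭_; module PermutationReasoning)
import Data.List.Relation.Binary.Permutation.Propositional.Properties as Permutation
open import Data.List.Relation.Binary.BagAndSetEquality using (∼bag⇒↭)
open import Data.Vec as Vec using (Vec; []; _∷_; toList)
open import Data.Vec.Properties using (toList-injective; cast-is-id; length-toList; ∷-injectiveʳ)
open import Data.Product using (∃; _×_; _,_; proj₁; proj₂)
open import Data.Product.Properties using (,-injectiveʳ)
open import Data.Unit using (⊤; tt)
open import Data.Empty using (⊥-elim)
open import Function using (_∘_; id; _⇔_; mk⇔; Equivalence)
open import Level using (0ℓ)
open import Relation.Nullary using (¬_; ¬?; yes; no)
open import Relation.Nullary.Decidable using (_×-dec_)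
open import Relation.Unary using (Pred; Decidable)
open import Relation.Binary.PropositionalEquality

private variable
  A B C : Set
  n ℓ : ℕ

∈-concatMap⁺′ : (f : A → List B) {x : A} {xs : List A} {y : B} →
                y ∈ f x → x ∈ xs → y ∈ concatMap f xs
∈-concatMap⁺′ f y∈fx x∈xs = ∈-concatMap⁺ f (lose x∈xs y∈fx)

∈-concatMap⁻′ : (f : A → List B) (xs : List A) {y : B} →
                y ∈ concatMap f xs → ∃ λ x → x ∈ xs × y ∈ f x
∈-concatMap⁻′ f xs = find ∘ ∈-concatMap⁻ f {xs = xs}

Unique-concatMap⁺ : (t : B → C) (k : A → C) (f : A → List B) (xs : List A) →
                    Unique (map k xs) → (∀ x → Unique (f x)) →
                    (∀ x {y} → y ∈ f x → t y ≡ k x) → Unique (concatMap f xs)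
Unique-concatMap⁺ t k f []       _              _        _   = []
Unique-concatMap⁺ t k f (x ∷ xs) (kx∉kxs ∷ uxs) unique-f tag =
  Unique.++⁺ (unique-f x) (Unique-concatMap⁺ t k f xs uxs unique-f tag) disjoint
  where
  disjoint : ∀ {y} → ¬ (y ∈ f x × y ∈ concatMap f xs)
  disjoint (y∈fx , y∈rest) with ∈-concatMap⁻′ f xs y∈rest
  ... | x′ , x′∈xs , y∈fx′ =
    All.lookup kx∉kxs (∈-map⁺ k x′∈xs) (trans (sym (tag x y∈fx)) (tag x′ y∈fx′))

filter-cong-∈ : {P Q : Pred A 0ℓ} (P? : Decidable P) (Q? : Decidable Q) (xs : List A) →
                (∀ x → x ∈ xs → P x ⇔ Q x) → filter P? xs ≡ filter Q? xs
filter-cong-∈ P? Q? []       _   = refl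
filter-cong-∈ P? Q? (x ∷ xs) P⇔Q with P? x | P⇔Q x (here refl)
... | yes px | equiv = trans (cong (x ∷_) (filter-cong-∈ P? Q? xs (λ y → P⇔Q y ∘ there)))
                             (sym (List.filter-accept Q? (Equivalence.to equiv px)))
... | no ¬px | equiv = trans (filter-cong-∈ P? Q? xs (λ y → P⇔Q y ∘ there))
                             (sym (List.filter-reject Q? (¬px ∘ Equivalence.from equiv)))

filter≡[_] : {Q : Pred A 0ℓ} {Q? : Decidable Q} {xs : List A} (x₀ : A) → Unique xs → x₀ ∈ xs →
             (∀ x → x ∈ xs → Q x → x ≡ x₀) → Q x₀ → filter Q? xs ≡ x₀ ∷ []
filter≡[_] {Q? = Q?} {x ∷ xs} x (x∉xs ∷ _) (here refl) only-x₀ qx =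
  trans (List.filter-accept Q? qx)
        (cong (x ∷_) (List.filter-none Q? (All.tabulate λ y∈xs qy →
          All.lookup x∉xs y∈xs (sym (only-x₀ _ (there y∈xs) qy)))))
filter≡[_] {Q? = Q?} {x ∷ xs} x₀ (x∉xs ∷ uxs) (there x₀∈xs) only-x₀ qx₀ =
  trans (List.filter-reject Q? (λ qx → All.lookup x∉xs x₀∈xs (only-x₀ x (here refl) qx)))
        (filter≡[ x₀ ] uxs x₀∈xs (λ y → only-x₀ y ∘ there) qx₀)

concatMap-concatMap : (g : B → List C) (f : A → List B) (xs : List A) →
                      concatMap g (concatMap f xs) ≡ concatMap (concatMap g ∘ f) xs
concatMap-concatMap g f []       = refl
concatMap-concatMap g f (x ∷ xs) =
  trans (List.concatMap-++ g (f x) (concatMap f xs))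
        (cong (concatMap g (f x) ++_) (concatMap-concatMap g f xs))

concatMap-cong-∈ : (f g : A → List B) (xs : List A) →
                   (∀ x → x ∈ xs → f x ≡ g x) → concatMap f xs ≡ concatMap g xs
concatMap-cong-∈ f g []       _   = refl
concatMap-cong-∈ f g (x ∷ xs) f≡g =
  cong₂ _++_ (f≡g x (here refl)) (concatMap-cong-∈ f g xs (λ y → f≡g y ∘ there))

-- Partial sums and dominance

-- psums hides its accumulator; psumsFrom s recovers it, since psums (s ∷ xs) = s ∷ psumsFrom s xs.
psumsFrom : ℕ → List ℕ → List ℕ
psumsFrom s xs = drop 1 (psums (s ∷ xs))

psumsFrom≡map : ∀ s xs → psumsFrom s xs ≡ map (s +_) (psums xs)
psumsFrom≡map s []       = refl
psumsFrom≡map s (x ∷ xs) = cong ((s + x) ∷_) (begin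
  psumsFrom (s + x) xs               ≡⟨ psumsFrom≡map (s + x) xs ⟩
  map ((s + x) +_) (psums xs)        ≡⟨ List.map-cong (+-assoc s x) (psums xs) ⟩
  map ((s +_) ∘ (x +_)) (psums xs)   ≡⟨ List.map-∘ (psums xs) ⟩
  map (s +_) (map (x +_) (psums xs)) ≡⟨ cong (map (s +_)) (psumsFrom≡map x xs) ⟨
  map (s +_) (psumsFrom x xs)        ∎)
  where open ≡-Reasoning

psums-∷ : ∀ x xs → psums (x ∷ xs) ≡ x ∷ map (x +_) (psums xs)
psums-∷ x xs = cong (x ∷_) (psumsFrom≡map x xs)

psums-injective : ∀ xs ys → psums xs ≡ psums ys → xs ≡ ys
psums-injective []       []       _  = refl
psums-injective (x ∷ xs) (y ∷ ys) eq
  with refl , eq′ ← List.∷-injective (trans (sym (psums-∷ x xs)) (trans eq (psums-∷ y ys))) =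
  cong (x ∷_) (psums-injective xs ys (List.map-injective (+-cancelˡ-≡ x _ _) eq′))

⊵-trans : {c d e : WC n} → c ⊵ d → d ⊵ e → c ⊵ e
⊵-trans c⊵d d⊵e = Pointwise.transitive ≤-trans d⊵e c⊵d

toList-injective′ : {u v : Vec A n} → toList u ≡ toList v → u ≡ v
toList-injective′ {u = u} {v} eq = trans (sym (cast-is-id refl u)) (toList-injective refl u v eq)

⊵-antisym : {c d : WC n} → c ⊵ d → d ⊵ c → c ≡ d
⊵-antisym c⊵d d⊵c = toList-injective′ (psums-injective _ _
  (Pointwise.Pointwise-≡⇒≡ (Pointwise.antisymmetric ≤-antisym d⊵c c⊵d)))

indicator : ℕ → ℕ
indicator zero    = 0
indicator (suc _) = 1

supportSize : Vec ℕ n → ℕ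
supportSize c = sum (map indicator (toList c))

supportCounts : Vec ℕ n → List ℕ
supportCounts c = psums (map indicator (toList c))

prefixSum : List ℕ → ℕ → ℕ
prefixSum γ k = sum (take k γ)

prefixSum-[] : ∀ k → prefixSum [] k ≡ 0
prefixSum-[] zero    = refl
prefixSum-[] (suc k) = refl

Positive : List ℕ → Set
Positive = All (0 <_)

psums-fill : (c : Vec ℕ n) (γ : List ℕ) →
             psums (toList (fill c γ)) ≡ map (prefixSum γ) (supportCounts c)
psums-fill []          γ       = refl
psums-fill (zero  ∷ c) γ       = cong (0 ∷_) (psums-fill c γ)
psums-fill (suc _ ∷ c) []      = cong (0 ∷_) (begin
  psums (toList (fill c []))                           ≡⟨ psums-fill c [] ⟩
  map (prefixSum []) (supportCounts c)                 ≡⟨ List.map-cong prefixSum-[] (supportCounts c) ⟩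
  map (λ _ → 0) (supportCounts c)                      ≡⟨ List.map-∘ (supportCounts c) ⟩
  map (prefixSum []) (map suc (supportCounts c))       ≡⟨ cong (map (prefixSum [])) (psumsFrom≡map 1 _) ⟨
  map (prefixSum []) (psumsFrom 1 (map indicator (toList c))) ∎)
  where open ≡-Reasoning
psums-fill (suc x ∷ c) (g ∷ γ) = begin
  psums (g ∷ toList (fill c γ))                          ≡⟨ psums-∷ g _ ⟩
  g ∷ map (g +_) (psums (toList (fill c γ)))             ≡⟨ cong (λ xs → g ∷ map (g +_) xs) (psums-fill c γ) ⟩
  g ∷ map (g +_) (map (prefixSum γ) (supportCounts c))   ≡⟨ cong₂ _∷_ (+-identityʳ g) (List.map-∘ _) ⟨
  g + 0 ∷ map (prefixSum (g ∷ γ) ∘ suc) (supportCounts c) ≡⟨ cong (g + 0 ∷_) (List.map-∘ _) ⟩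
  map (prefixSum (g ∷ γ)) (1 ∷ map suc (supportCounts c)) ≡⟨ cong (map (prefixSum (g ∷ γ))) (psums-∷ 1 _) ⟨
  map (prefixSum (g ∷ γ)) (supportCounts (suc x ∷ c))   ∎
  where open ≡-Reasoning

fill-flat : (c : Vec ℕ n) → fill c (flat c) ≡ c
fill-flat []          = refl
fill-flat (zero  ∷ c) = cong (0 ∷_) (fill-flat c)
fill-flat (suc x ∷ c) = cong (suc x ∷_) (fill-flat c)

flat-fill : (c : Vec ℕ n) (γ : List ℕ) → supportSize c ≡ length γ → flat (fill c γ) ≡ flatL γ
flat-fill []          []          _  = refl
flat-fill (zero  ∷ c) γ           eq = flat-fill c γ eq
flat-fill (suc _ ∷ c) (zero  ∷ γ) eq = flat-fill c γ (suc-injective eq)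
flat-fill (suc _ ∷ c) (suc g ∷ γ) eq = cong (suc g ∷_) (flat-fill c γ (suc-injective eq))

fill-+v : (c : Vec ℕ n) (u v : Vec ℕ ℓ) → fill c (toList (u +v v)) ≡ fill c (toList u) +v fill c (toList v)
fill-+v []          u       v       = refl
fill-+v (zero  ∷ c) u       v       = cong (0 ∷_) (fill-+v c u v)
fill-+v (suc _ ∷ c) []      []      = cong (0 ∷_) (fill-+v c [] [])
fill-+v (suc _ ∷ c) (x ∷ u) (y ∷ v) = cong (x + y ∷_) (fill-+v c u v)

flatL-positive : {γ : List ℕ} → Positive γ → flatL γ ≡ γ
flatL-positive γ⁺ = List.filter-all _ (All.map n>0⇒n≢0 γ⁺)

length-flat : (c : Vec ℕ n) → length (flat c) ≡ supportSize c
length-flat []          = refl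
length-flat (zero  ∷ c) = length-flat c
length-flat (suc _ ∷ c) = cong suc (length-flat c)

supportSize≡length-flat : {c : WC n} {L : List ℕ} → flat c ≡ L → supportSize c ≡ length L
supportSize≡length-flat {c = c} refl = sym (length-flat c)

supportCounts-fill : (c : Vec ℕ n) {γ : List ℕ} → Positive γ → supportSize c ≤ length γ →
                     supportCounts (fill c γ) ≡ supportCounts c
supportCounts-fill c γ⁺ size≤ = cong psums (indicators c γ⁺ size≤)
  where
  indicators : (c : Vec ℕ n) {γ : List ℕ} → Positive γ → supportSize c ≤ length γ →
               map indicator (toList (fill c γ)) ≡ map indicator (toList c)
  indicators []          _         _         = refl
  indicators (zero  ∷ c) γ⁺        size≤     = cong (0 ∷_) (indicators c γ⁺ size≤)
  indicators (suc _ ∷ c) (s≤s _ ∷ γ⁺) (s≤s size≤) = cong (1 ∷_) (indicators c γ⁺ size≤)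

supportCounts≤supportSize : (c : Vec ℕ n) → All (_≤ supportSize c) (supportCounts c)
supportCounts≤supportSize []          = []
supportCounts≤supportSize (zero  ∷ c) = z≤n ∷ supportCounts≤supportSize c
supportCounts≤supportSize (suc x ∷ c) = s≤s z≤n ∷ subst (All (_≤ suc (supportSize c)))
  (sym (psumsFrom≡map 1 _)) (All.map⁺ (All.map s≤s (supportCounts≤supportSize c)))

prefixSum-mono : ∀ γ {k k′} → k ≤ k′ → prefixSum γ k ≤ prefixSum γ k′
prefixSum-mono γ       {zero}              _         = z≤n
prefixSum-mono []      {suc k} {suc k′}   _         = z≤n
prefixSum-mono (g ∷ γ) {suc k} {suc k′}   (s≤s k≤k′) = +-monoʳ-≤ g (prefixSum-mono γ k≤k′)

prefixSum-strict : ∀ {s} → Positive s → ∀ {k k′} → k < k′ → k′ ≤ length s → prefixSum s k < prefixSum s k′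
prefixSum-strict {g ∷ s} (g>0 ∷ _)  {zero}  {suc k′} _          _           = ≤-trans g>0 (m≤m+n g _)
prefixSum-strict {g ∷ s} (_ ∷ s⁺) {suc k} {suc k′} (s≤s k<k′) (s≤s k′≤|s|) =
  +-monoʳ-< g (prefixSum-strict s⁺ k<k′ k′≤|s|)

prefixSum-cancel-≤ : ∀ {s} → Positive s → ∀ {k k′} → k ≤ length s →
                     prefixSum s k ≤ prefixSum s k′ → k ≤ k′
prefixSum-cancel-≤ s⁺ {k} {k′} k≤|s| Sk≤Sk′ with k ≤? k′
... | yes k≤k′ = k≤k′
... | no  k≰k′ = ⊥-elim (<⇒≱ (prefixSum-strict s⁺ (≰⇒> k≰k′) k≤|s|) Sk≤Sk′)

Pointwise-prefixSum⁻ : ∀ {s} → Positive s → ∀ {xs ys} → All (_≤ length s) xs →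
                       Pointwise _≤_ (map (prefixSum s) xs) (map (prefixSum s) ys) → Pointwise _≤_ xs ys
Pointwise-prefixSum⁻ s⁺ {[]}     {[]}     []          []       = []
Pointwise-prefixSum⁻ s⁺ {x ∷ xs} {y ∷ ys} (x≤ ∷ xs≤) (Sx≤Sy ∷ rest) =
  prefixSum-cancel-≤ s⁺ x≤ Sx≤Sy ∷ Pointwise-prefixSum⁻ s⁺ xs≤ rest

psums≡prefixSums : (c : Vec ℕ n) → psums (toList c) ≡ map (prefixSum (flat c)) (supportCounts c)
psums≡prefixSums c = trans (cong (psums ∘ toList) (sym (fill-flat c))) (psums-fill c (flat c))

-- For compositions with a common positive flattening s, dominance is the
-- pointwise order on supportCounts, and that order is preserved by any fill.

⊵⇒supportCounts-≤ : ∀ {s} → Positive s → {c d : WC n} → flat c ≡ s → flat d ≡ s → d ⊵ c →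
                    Pointwise _≤_ (supportCounts c) (supportCounts d)
⊵⇒supportCounts-≤ s⁺ {c} {d} refl d-flat d⊵c = Pointwise-prefixSum⁻ s⁺ c-bounded
  (subst₂ (Pointwise _≤_) (psums≡prefixSums c)
    (trans (psums≡prefixSums d) (cong (λ s → map (prefixSum s) (supportCounts d)) d-flat)) d⊵c)
  where
  c-bounded : All (_≤ length (flat c)) (supportCounts c)
  c-bounded = subst (λ m → All (_≤ m) (supportCounts c)) (sym (length-flat c)) (supportCounts≤supportSize c)

supportCounts-≤⇒fill-⊵ : {c d : WC n} (γ : List ℕ) →
                         Pointwise _≤_ (supportCounts c) (supportCounts d) → fill d γ ⊵ fill c γ
supportCounts-≤⇒fill-⊵ {c = c} {d} γ c≤d =
  subst₂ (Pointwise _≤_) (sym (psums-fill c γ)) (sym (psums-fill d γ))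
    (Pointwise.map⁺ _ _ (Pointwise.map (prefixSum-mono γ) c≤d))

supportCounts-≤⇒⊵ : {c d : WC n} → flat c ≡ flat d →
                    Pointwise _≤_ (supportCounts c) (supportCounts d) → d ⊵ c
supportCounts-≤⇒⊵ {c = c} {d} same-flat c≤d =
  subst₂ _⊵_ (fill-flat d) (trans (cong (fill c) (sym same-flat)) (fill-flat c))
    (supportCounts-≤⇒fill-⊵ (flat d) c≤d)

-- Meets

indicator≤1 : ∀ x → indicator x ≤ 1
indicator≤1 zero    = z≤n
indicator≤1 (suc _) = s≤s z≤n

indicator-≤1 : ∀ {v} → v ≤ 1 → indicator v ≡ v
indicator-≤1 {zero}        _         = refl
indicator-≤1 {suc zero}    _         = refl
indicator-≤1 {suc (suc _)} (s≤s ())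

-- The running count of meetPattern i j c d, started at i ⊓ j, is the minimum of
-- the running counts of c and d, started at i and j.
meetPattern : ℕ → ℕ → Vec ℕ n → Vec ℕ n → Vec ℕ n
meetPattern i j []      []      = []
meetPattern i j (x ∷ c) (y ∷ d) =
  ((i + indicator x) ⊓ (j + indicator y) ∸ i ⊓ j) ∷ meetPattern (i + indicator x) (j + indicator y) c d

meetPattern-step : ∀ i j x y →
  i ⊓ j + indicator ((i + indicator x) ⊓ (j + indicator y) ∸ i ⊓ j) ≡ (i + indicator x) ⊓ (j + indicator y)
meetPattern-step i j x y = trans (cong (i ⊓ j +_) (indicator-≤1 step≤1)) (m+[n∸m]≡n lower)
  where
  lower : i ⊓ j ≤ (i + indicator x) ⊓ (j + indicator y)
  lower = ⊓-mono-≤ (m≤m+n i _) (m≤m+n j _)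
  upper : (i + indicator x) ⊓ (j + indicator y) ≤ suc (i ⊓ j)
  upper = ⊓-mono-≤ (≤-trans (+-monoʳ-≤ i (indicator≤1 x)) (≤-reflexive (+-comm i 1)))
                   (≤-trans (+-monoʳ-≤ j (indicator≤1 y)) (≤-reflexive (+-comm j 1)))
  step≤1 : (i + indicator x) ⊓ (j + indicator y) ∸ i ⊓ j ≤ 1
  step≤1 = ≤-trans (∸-monoˡ-≤ (i ⊓ j) upper) (≤-reflexive (m+n∸n≡m 1 (i ⊓ j)))

psumsFrom-meetPattern : ∀ i j (c d : Vec ℕ n) →
  psumsFrom (i ⊓ j) (map indicator (toList (meetPattern i j c d))) ≡
  zipWith _⊓_ (psumsFrom i (map indicator (toList c))) (psumsFrom j (map indicator (toList d)))
psumsFrom-meetPattern i j []      []      = refl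
psumsFrom-meetPattern i j (x ∷ c) (y ∷ d) rewrite meetPattern-step i j x y =
  cong (_ ∷_) (psumsFrom-meetPattern (i + indicator x) (j + indicator y) c d)

supportSize-meetPattern : ∀ i j (c d : Vec ℕ n) →
  i ⊓ j + supportSize (meetPattern i j c d) ≡ (i + supportSize c) ⊓ (j + supportSize d)
supportSize-meetPattern i j []      []      =
  trans (+-identityʳ (i ⊓ j)) (cong₂ _⊓_ (sym (+-identityʳ i)) (sym (+-identityʳ j)))
supportSize-meetPattern i j (x ∷ c) (y ∷ d) = begin
  i ⊓ j + (indicator v + supportSize (meetPattern i′ j′ c d)) ≡⟨ +-assoc (i ⊓ j) (indicator v) _ ⟨
  i ⊓ j + indicator v + supportSize (meetPattern i′ j′ c d)   ≡⟨ cong (_+ supportSize (meetPattern i′ j′ c d)) (meetPattern-step i j x y) ⟩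
  i′ ⊓ j′ + supportSize (meetPattern i′ j′ c d)               ≡⟨ supportSize-meetPattern i′ j′ c d ⟩
  (i′ + supportSize c) ⊓ (j′ + supportSize d)                 ≡⟨ cong₂ _⊓_ (+-assoc i _ _) (+-assoc j _ _) ⟩
  (i + supportSize (x ∷ c)) ⊓ (j + supportSize (y ∷ d))       ∎
  where
  open ≡-Reasoning
  i′ = i + indicator x
  j′ = j + indicator y
  v = i′ ⊓ j′ ∸ i ⊓ j

zipWith-⊓-≤ˡ : ∀ {xs ys} → length xs ≡ length ys → Pointwise _≤_ (zipWith _⊓_ xs ys) xs
zipWith-⊓-≤ˡ {[]}     {[]}     _  = []
zipWith-⊓-≤ˡ {x ∷ xs} {y ∷ ys} eq = m⊓n≤m x y ∷ zipWith-⊓-≤ˡ (suc-injective eq)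

zipWith-⊓-≤ʳ : ∀ {xs ys} → length xs ≡ length ys → Pointwise _≤_ (zipWith _⊓_ xs ys) ys
zipWith-⊓-≤ʳ {[]}     {[]}     _  = []
zipWith-⊓-≤ʳ {x ∷ xs} {y ∷ ys} eq = m⊓n≤n x y ∷ zipWith-⊓-≤ʳ (suc-injective eq)

zipWith-⊓-glb : ∀ {xs ys zs} → Pointwise _≤_ xs ys → Pointwise _≤_ xs zs →
                Pointwise _≤_ xs (zipWith _⊓_ ys zs)
zipWith-⊓-glb []             []             = []
zipWith-⊓-glb (x≤y ∷ xs≤ys) (x≤z ∷ xs≤zs) = ⊓-glb x≤y x≤z ∷ zipWith-⊓-glb xs≤ys xs≤zs

map-zipWith-⊓ : ∀ {f : ℕ → ℕ} → (∀ {x y} → x ≤ y → f x ≤ f y) → ∀ xs ys →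
                map f (zipWith _⊓_ xs ys) ≡ zipWith _⊓_ (map f xs) (map f ys)
map-zipWith-⊓ f-mono []       _        = refl
map-zipWith-⊓ f-mono (_ ∷ _)  []       = refl
map-zipWith-⊓ f-mono (x ∷ xs) (y ∷ ys) = cong₂ _∷_ (mono-≤-distrib-⊓ f-mono x y) (map-zipWith-⊓ f-mono xs ys)

length-psums : ∀ xs → length (psums xs) ≡ length xs
length-psums []       = refl
length-psums (x ∷ xs) = cong suc (begin
  length (psumsFrom x xs)          ≡⟨ cong length (psumsFrom≡map x xs) ⟩
  length (map (x +_) (psums xs))   ≡⟨ List.length-map (x +_) (psums xs) ⟩
  length (psums xs)                ≡⟨ length-psums xs ⟩
  length xs                        ∎)
  where open ≡-Reasoning

length-supportCounts : (c : Vec ℕ n) → length (supportCounts c) ≡ n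
length-supportCounts {n} c = begin
  length (psums (map indicator (toList c))) ≡⟨ length-psums (map indicator (toList c)) ⟩
  length (map indicator (toList c))         ≡⟨ List.length-map indicator (toList c) ⟩
  length (toList c)                         ≡⟨ length-toList c ⟩
  n                                         ∎
  where open ≡-Reasoning

-- Two compositions with the same flattening have a greatest lower bound for
-- dominance with that flattening: the one whose supportCounts are the pointwise minimum.
meet : Vec ℕ n → Vec ℕ n → Vec ℕ n
meet c d = fill (meetPattern 0 0 c d) (flat c)

module _ {s : List ℕ} (s⁺ : Positive s) (c d : WC n) (c-flat : flat c ≡ s) (d-flat : flat d ≡ s) where

  private
    pattern-size : supportSize (meetPattern 0 0 c d) ≡ length (flat c)
    pattern-size = begin
      supportSize (meetPattern 0 0 c d) ≡⟨ supportSize-meetPattern 0 0 c d ⟩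
      supportSize c ⊓ supportSize d     ≡⟨ cong₂ _⊓_ (supportSize≡length-flat {c = c} c-flat) (supportSize≡length-flat {c = d} d-flat) ⟩
      length s ⊓ length s               ≡⟨ ⊓-idem (length s) ⟩
      length s                          ≡⟨ cong length c-flat ⟨
      length (flat c)                   ∎
      where open ≡-Reasoning

    flat-c⁺ : Positive (flat c)
    flat-c⁺ = subst Positive (sym c-flat) s⁺

    same-length : length (supportCounts c) ≡ length (supportCounts d)
    same-length = trans (length-supportCounts c) (sym (length-supportCounts d))

  flat-meet : flat (meet c d) ≡ s
  flat-meet = trans (flat-fill (meetPattern 0 0 c d) (flat c) pattern-size)
                    (trans (flatL-positive flat-c⁺) c-flat)

  supportCounts-meet : supportCounts (meet c d) ≡ zipWith _⊓_ (supportCounts c) (supportCounts d)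
  supportCounts-meet = trans (supportCounts-fill (meetPattern 0 0 c d) flat-c⁺ (≤-reflexive pattern-size))
                             (psumsFrom-meetPattern 0 0 c d)

  ⊵-meetˡ : c ⊵ meet c d
  ⊵-meetˡ = supportCounts-≤⇒⊵ (trans flat-meet (sym c-flat))
    (subst (λ xs → Pointwise _≤_ xs (supportCounts c)) (sym supportCounts-meet) (zipWith-⊓-≤ˡ same-length))

  ⊵-meetʳ : d ⊵ meet c d
  ⊵-meetʳ = supportCounts-≤⇒⊵ (trans flat-meet (sym d-flat))
    (subst (λ xs → Pointwise _≤_ xs (supportCounts d)) (sym supportCounts-meet) (zipWith-⊓-≤ʳ same-length))

  fill-meet-⊵ : (γ : List ℕ) (a : WC n) → fill c γ ⊵ a → fill d γ ⊵ a → fill (meet c d) γ ⊵ a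
  fill-meet-⊵ γ a c⊵a d⊵a = subst (Pointwise _≤_ (psums (toList a))) (sym psums-fill-meet)
    (zipWith-⊓-glb (subst (Pointwise _≤_ _) (psums-fill c γ) c⊵a)
                   (subst (Pointwise _≤_ _) (psums-fill d γ) d⊵a))
    where
    psums-fill-meet : psums (toList (fill (meet c d) γ)) ≡
                      zipWith _⊓_ (map (prefixSum γ) (supportCounts c)) (map (prefixSum γ) (supportCounts d))
    psums-fill-meet = begin
      psums (toList (fill (meet c d) γ))                                   ≡⟨ psums-fill (meet c d) γ ⟩
      map (prefixSum γ) (supportCounts (meet c d))                         ≡⟨ cong (map (prefixSum γ)) supportCounts-meet ⟩
      map (prefixSum γ) (zipWith _⊓_ (supportCounts c) (supportCounts d)) ≡⟨ map-zipWith-⊓ (prefixSum-mono γ) _ _ ⟩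
      zipWith _⊓_ (map (prefixSum γ) (supportCounts c)) (map (prefixSum γ) (supportCounts d)) ∎
      where open ≡-Reasoning

∈-allVecs : ∀ n k (v : Vec ℕ n) → All (_≤ k) (toList v) → v ∈ allVecs n k
∈-allVecs zero    k []      _           = here refl
∈-allVecs (suc n) k (x ∷ v) (x≤k ∷ v≤k) =
  ∈-concatMap⁺′ (λ x → map (x ∷_) (allVecs n k)) (∈-map⁺ (x ∷_) (∈-allVecs n k v v≤k)) (∈-upTo⁺ (s≤s x≤k))

Unique-allVecs : ∀ n k → Unique (allVecs n k)
Unique-allVecs zero    k = [] ∷ []
Unique-allVecs (suc n) k =
  Unique-concatMap⁺ Vec.head id (λ x → map (x ∷_) (allVecs n k)) (upTo (suc k))
    (subst Unique (sym (List.map-id _)) (Unique.upTo⁺ (suc k)))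
    (λ x → Unique.map⁺ ∷-injectiveʳ (Unique-allVecs n k))
    head≡
  where
  head≡ : ∀ x {v} → v ∈ map (x ∷_) (allVecs n k) → Vec.head v ≡ x
  head≡ x v∈ with _ , _ , refl ← ∈-map⁻ (x ∷_) v∈ = refl

entries≤sum-flatL : ∀ xs → All (_≤ sum (flatL xs)) xs
entries≤sum-flatL []           = []
entries≤sum-flatL (zero  ∷ xs) = z≤n ∷ entries≤sum-flatL xs
entries≤sum-flatL (suc x ∷ xs) =
  m≤m+n (suc x) _ ∷ All.map (λ y≤ → ≤-trans y≤ (m≤n+m _ (suc x))) (entries≤sum-flatL xs)

∈-withFlat⁺ : {L : List ℕ} (d : WC n) → flat d ≡ L → d ∈ withFlat n L
∈-withFlat⁺ {n} d refl = ∈-filter⁺ (λ e → flat e ≟L flat d) (∈-allVecs n _ d (entries≤sum-flatL (toList d))) refl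

∈-withFlat⁻ : {L : List ℕ} {d : WC n} → d ∈ withFlat n L → flat d ≡ L
∈-withFlat⁻ {n} {L} d∈ = proj₂ (∈-filter⁻ (λ e → flat e ≟L L) {xs = allVecs n (sum L)} d∈)

Unique-withFlat : ∀ n L → Unique (withFlat n L)
Unique-withFlat n L = Unique.filter⁺ (λ d → flat d ≟L L) (Unique-allVecs n (sum L))

∈-slide⁺ : {c d : WC n} → flat d ≡ flat c → d ⊵ c → d ∈ slide c
∈-slide⁺ {c = c} {d} d-flat d⊵c = ∈-filter⁺ (_⊵? c) (∈-withFlat⁺ d d-flat) d⊵c

∈-slide⁻ : {c d : WC n} → d ∈ slide c → flat d ≡ flat c × d ⊵ c
∈-slide⁻ {n} {c} d∈ with d∈withFlat , d⊵c ← ∈-filter⁻ (_⊵? c) {xs = withFlat n (flat c)} d∈ =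
  ∈-withFlat⁻ d∈withFlat , d⊵c

Unique-slide : (c : WC n) → Unique (slide c)
Unique-slide {n} c = Unique.filter⁺ (_⊵? c) (Unique-withFlat n (flat c))

IsCandidate : (a b : WC n) (γa γb : WC ℓ) → WC n → Set
IsCandidate a b γa γb c = flat c ≡ toList (γa +v γb) × fill c (toList γa) ⊵ a × fill c (toList γb) ⊵ b

∈-candidates⁺ : {a b : WC n} {γa γb : WC ℓ} {c : WC n} → IsCandidate a b γa γb c → c ∈ candidates a b γa γb
∈-candidates⁺ {a = a} {b} {γa} {γb} {c} (c-flat , fill-a , fill-b) =
  ∈-filter⁺ (λ c → (fill c (toList γa) ⊵? a) ×-dec (fill c (toList γb) ⊵? b)) (∈-withFlat⁺ c c-flat) (fill-a , fill-b)

∈-candidates⁻ : {a b : WC n} {γa γb : WC ℓ} {c : WC n} → c ∈ candidates a b γa γb → IsCandidate a b γa γb c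
∈-candidates⁻ {n} {a = a} {b} {γa} {γb} c∈
  with c∈withFlat , fill-a , fill-b ← ∈-filter⁻ (λ c → (fill c (toList γa) ⊵? a) ×-dec (fill c (toList γb) ⊵? b))
                                        {xs = withFlat n (toList (γa +v γb))} c∈ =
  ∈-withFlat⁻ c∈withFlat , fill-a , fill-b

Unique-candidates : (a b : WC n) (γa γb : WC ℓ) → Unique (candidates a b γa γb)
Unique-candidates {n} a b γa γb = Unique.filter⁺ _ (Unique-withFlat n (toList (γa +v γb)))

InQSS : (a b : WC n) (γa γb : WC ℓ) → Set
InQSS a b γa γb = (flat γa ≡ flat a) × (flat γb ≡ flat b) ×
                  Positive (toList (γa +v γb)) × Any (λ _ → ⊤) (candidates a b γa γb)

-- The blocks of QSS a b, definitionally equal to those local to its definition.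
QSSOfLength : (a b : WC n) → ℕ → List QSSElem
QSSOfLength a b ℓ = concatMap (λ γa → pairsWith γa) (withFlat ℓ (flat a))
  module QSSOfLength where
  pairsWith : WC ℓ → List QSSElem
  pairsWith γa = concatMap (λ γb → filter (λ _ → inQSS? a b γa γb) ((ℓ , γa , γb) ∷ [])) (withFlat ℓ (flat b))

∈-QSS⁺ : (a b : WC n) {γa γb : WC ℓ} → ℓ ≤ length (flat a) + length (flat b) → InQSS a b γa γb →
         (ℓ , γa , γb) ∈ QSS a b
∈-QSS⁺ a b {γa} {γb} ℓ≤ inQSS@(γa-flat , γb-flat , _) =
  ∈-concatMap⁺′ (QSSOfLength a b)
    (∈-concatMap⁺′ (QSSOfLength.pairsWith a b _)
      (∈-concatMap⁺′ (λ γb → filter (λ _ → inQSS? a b γa γb) ((_ , γa , γb) ∷ []))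
        (∈-filter⁺ (λ _ → inQSS? a b γa γb) (here refl) inQSS)
        (∈-withFlat⁺ γb γb-flat))
      (∈-withFlat⁺ γa γa-flat))
    (∈-upTo⁺ (s≤s ℓ≤))

∈-QSS⁻ : (a b : WC n) {γa γb : WC ℓ} → (ℓ , γa , γb) ∈ QSS a b → InQSS a b γa γb
∈-QSS⁻ a b q∈
  with ℓ , _ , q∈block  ← ∈-concatMap⁻′ (QSSOfLength a b) (upTo (suc (length (flat a) + length (flat b)))) q∈
  with γa , _ , q∈pairs ← ∈-concatMap⁻′ (QSSOfLength.pairsWith a b ℓ) (withFlat ℓ (flat a)) q∈block
  with γb , _ , q∈one   ← ∈-concatMap⁻′ (λ γb → filter (λ _ → inQSS? a b γa γb) ((ℓ , γa , γb) ∷ []))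
                                        (withFlat ℓ (flat b)) q∈pairs
  with here refl , inQSS ← ∈-filter⁻ (λ _ → inQSS? a b γa γb) {xs = (ℓ , γa , γb) ∷ []} q∈one = inQSS

Unique-QSS : (a b : WC n) → Unique (QSS a b)
Unique-QSS a b = Unique-concatMap⁺ proj₁ id (QSSOfLength a b) lengths
  (subst Unique (sym (List.map-id lengths)) (Unique.upTo⁺ _)) Unique-block block-length
  where
  open QSSOfLength a b

  lengths : List ℕ
  lengths = upTo (suc (length (flat a) + length (flat b)))

  single : ∀ {ℓ} (γa γb : WC ℓ) → List QSSElem
  single γa γb = filter (λ _ → inQSS? a b γa γb) ((_ , γa , γb) ∷ [])

  single≡ : ∀ {ℓ} (γa γb : WC ℓ) {q} → q ∈ single γa γb → q ≡ (ℓ , γa , γb)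
  single≡ γa γb q∈ with here q≡ , _ ← ∈-filter⁻ (λ _ → inQSS? a b γa γb) {xs = (_ , γa , γb) ∷ []} q∈ = q≡

  pairsWith≡ : ∀ {ℓ} (γa : WC ℓ) {q} → q ∈ pairsWith ℓ γa → ∃ λ γb → q ≡ (ℓ , γa , γb)
  pairsWith≡ {ℓ} γa q∈ with γb , _ , q∈single ← ∈-concatMap⁻′ (single γa) (withFlat ℓ (flat b)) q∈ =
    γb , single≡ γa γb q∈single

  Unique-pairsWith : ∀ {ℓ} (γa : WC ℓ) → Unique (pairsWith ℓ γa)
  Unique-pairsWith {ℓ} γa = Unique-concatMap⁺ (λ q → toList (proj₂ (proj₂ q))) toList (single γa) _
    (Unique.map⁺ toList-injective′ (Unique-withFlat ℓ (flat b)))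
    (λ γb → Unique.filter⁺ (λ _ → inQSS? a b γa γb) ([] ∷ []))
    (λ γb q∈ → cong (λ q → toList (proj₂ (proj₂ q))) (single≡ γa γb q∈))

  Unique-block : ∀ ℓ → Unique (QSSOfLength a b ℓ)
  Unique-block ℓ = Unique-concatMap⁺ (λ q → toList (proj₁ (proj₂ q))) toList (pairsWith ℓ) _
    (Unique.map⁺ toList-injective′ (Unique-withFlat ℓ (flat a)))
    Unique-pairsWith
    (λ γa q∈ → cong (λ q → toList (proj₁ (proj₂ q))) (proj₂ (pairsWith≡ γa q∈)))

  block-length : ∀ ℓ {q} → q ∈ QSSOfLength a b ℓ → proj₁ q ≡ ℓ
  block-length ℓ q∈ with γa , _ , q∈pairs ← ∈-concatMap⁻′ (pairsWith ℓ) (withFlat ℓ (flat a)) q∈ =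
    cong proj₁ (proj₂ (pairsWith≡ γa q∈pairs))

-- The bump

module _ {a b : WC n} {γa γb : WC ℓ} (sum⁺ : Positive (toList (γa +v γb))) where

  candidate-upward : {c d : WC n} → IsCandidate a b γa γb c → flat d ≡ toList (γa +v γb) → d ⊵ c →
                     IsCandidate a b γa γb d
  candidate-upward (c-flat , fill-a , fill-b) d-flat d⊵c =
    d-flat , ⊵-trans (supportCounts-≤⇒fill-⊵ (toList γa) c≤d) fill-a
           , ⊵-trans (supportCounts-≤⇒fill-⊵ (toList γb) c≤d) fill-b
    where c≤d = ⊵⇒supportCounts-≤ sum⁺ c-flat d-flat d⊵c

  candidate-meet : {c d : WC n} → IsCandidate a b γa γb c → IsCandidate a b γa γb d →
                   IsCandidate a b γa γb (meet c d)
  candidate-meet {c} {d} (c-flat , c-a , c-b) (d-flat , d-a , d-b) =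
    flat-meet sum⁺ c d c-flat d-flat , fill-meet-⊵ sum⁺ c d c-flat d-flat (toList γa) a c-a d-a
                                     , fill-meet-⊵ sum⁺ c d c-flat d-flat (toList γb) b c-b d-b

  meetAll : WC n → List (WC n) → WC n
  meetAll c []       = c
  meetAll c (d ∷ ds) = meet d (meetAll c ds)

  meetAll-candidate : {c : WC n} {ds : List (WC n)} → IsCandidate a b γa γb c →
                      All (IsCandidate a b γa γb) ds → IsCandidate a b γa γb (meetAll c ds)
  meetAll-candidate c-cand []               = c-cand
  meetAll-candidate c-cand (d-cand ∷ ds-cand) = candidate-meet d-cand (meetAll-candidate c-cand ds-cand)

  ⊵-meetAll : {c : WC n} {ds : List (WC n)} → IsCandidate a b γa γb c →
              All (IsCandidate a b γa γb) ds → ∀ {d} → d ∈ ds → d ⊵ meetAll c ds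
  ⊵-meetAll {c} {d ∷ ds} c-cand (d-cand ∷ ds-cand) (here refl) =
    ⊵-meetˡ sum⁺ d (meetAll c ds) (proj₁ d-cand) (proj₁ (meetAll-candidate c-cand ds-cand))
  ⊵-meetAll {c} {d ∷ ds} c-cand (d-cand ∷ ds-cand) (there e∈ds) =
    ⊵-trans (⊵-meetAll c-cand ds-cand e∈ds)
            (⊵-meetʳ sum⁺ d (meetAll c ds) (proj₁ d-cand) (proj₁ (meetAll-candidate c-cand ds-cand)))

  module _ (nonempty : Any (λ _ → ⊤) (candidates a b γa γb)) where

    private
      all-candidates : All (IsCandidate a b γa γb) (candidates a b γa γb)
      all-candidates = All.tabulate ∈-candidates⁻

      some-candidate : IsCandidate a b γa γb (proj₁ (find nonempty))
      some-candidate = ∈-candidates⁻ (proj₁ (proj₂ (find nonempty)))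

    least : WC n
    least = meetAll (proj₁ (find nonempty)) (candidates a b γa γb)

    least-candidate : IsCandidate a b γa γb least
    least-candidate = meetAll-candidate some-candidate all-candidates

    ⊵-least : ∀ {d} → d ∈ candidates a b γa γb → d ⊵ least
    ⊵-least = ⊵-meetAll some-candidate all-candidates

    bumps≡[least] : bumps a b γa γb ≡ least ∷ []
    bumps≡[least] = filter≡[ least ] (Unique-candidates a b γa γb) (∈-candidates⁺ least-candidate)
      (λ d d∈ below-all → ⊵-antisym (⊵-least d∈) (All.lookup below-all (∈-candidates⁺ least-candidate)))
      (All.tabulate ⊵-least)

    slide-least≡candidates : slide least ≡ candidates a b γa γb
    slide-least≡candidates = trans (cong (λ L → filter (_⊵? least) (withFlat n L)) (proj₁ least-candidate))
      (filter-cong-∈ (_⊵? least) _ (withFlat n (toList (γa +v γb))) λ d d∈ →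
        mk⇔ (proj₂ ∘ candidate-upward least-candidate (∈-withFlat⁻ d∈))
            (λ fills → ⊵-least (∈-candidates⁺ (∈-withFlat⁻ d∈ , fills))))

slide-bumps≡candidates : {a b : WC n} {γa γb : WC ℓ} → InQSS a b γa γb →
                         concatMap slide (bumps a b γa γb) ≡ candidates a b γa γb
slide-bumps≡candidates (_ , _ , sum⁺ , nonempty) = begin
  concatMap slide (bumps _ _ _ _)   ≡⟨ cong (concatMap slide) (bumps≡[least] sum⁺ nonempty) ⟩
  slide (least sum⁺ nonempty) ++ [] ≡⟨ List.++-identityʳ _ ⟩
  slide (least sum⁺ nonempty)       ≡⟨ slide-least≡candidates sum⁺ nonempty ⟩
  candidates _ _ _ _                ∎
  where open ≡-Reasoning

-- Splitting a pair of exponent vectors along the support of their sum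

restrict : (d c : Vec ℕ n) → Vec ℕ (supportSize c)
restrict []      []          = []
restrict (x ∷ d) (zero  ∷ c) = restrict d c
restrict (x ∷ d) (suc _ ∷ c) = x ∷ restrict d c

fill-restrict-+vˡ : (d e : Vec ℕ n) → fill (d +v e) (toList (restrict d (d +v e))) ≡ d
fill-restrict-+vˡ []          []          = refl
fill-restrict-+vˡ (zero  ∷ d) (zero  ∷ e) = cong (0 ∷_) (fill-restrict-+vˡ d e)
fill-restrict-+vˡ (zero  ∷ d) (suc _ ∷ e) = cong (0 ∷_) (fill-restrict-+vˡ d e)
fill-restrict-+vˡ (suc x ∷ d) (_     ∷ e) = cong (suc x ∷_) (fill-restrict-+vˡ d e)

fill-restrict-+vʳ : (d e : Vec ℕ n) → fill (d +v e) (toList (restrict e (d +v e))) ≡ e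
fill-restrict-+vʳ []          []          = refl
fill-restrict-+vʳ (zero  ∷ d) (zero  ∷ e) = cong (0 ∷_) (fill-restrict-+vʳ d e)
fill-restrict-+vʳ (zero  ∷ d) (suc y ∷ e) = cong (suc y ∷_) (fill-restrict-+vʳ d e)
fill-restrict-+vʳ (suc _ ∷ d) (y     ∷ e) = cong (y ∷_) (fill-restrict-+vʳ d e)

restrict-fill : (c : Vec ℕ n) (γ : Vec ℕ (supportSize c)) → restrict (fill c (toList γ)) c ≡ γ
restrict-fill []          []      = refl
restrict-fill (zero  ∷ c) γ       = restrict-fill c γ
restrict-fill (suc _ ∷ c) (g ∷ γ) = cong (g ∷_) (restrict-fill c γ)

restrict-+v : (d e c : Vec ℕ n) → restrict (d +v e) c ≡ restrict d c +v restrict e c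
restrict-+v []      []      []          = refl
restrict-+v (_ ∷ d) (_ ∷ e) (zero  ∷ c) = restrict-+v d e c
restrict-+v (x ∷ d) (y ∷ e) (suc _ ∷ c) = cong (x + y ∷_) (restrict-+v d e c)

restrict-self : (c : Vec ℕ n) → toList (restrict c c) ≡ flat c
restrict-self []          = refl
restrict-self (zero  ∷ c) = restrict-self c
restrict-self (suc x ∷ c) = cong (suc x ∷_) (restrict-self c)

flat-fill-supportSize : (c : Vec ℕ n) (γ : Vec ℕ (supportSize c)) → flat (fill c (toList γ)) ≡ flat γ
flat-fill-supportSize c γ = flat-fill c (toList γ) (sym (length-toList γ))

flat-positive : (c : Vec ℕ n) → Positive (flat c)
flat-positive c = All.map n≢0⇒n>0 (All.all-filter (λ x → ¬? (x ≟ 0)) (toList c))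

supportSize-+v : (d e : Vec ℕ n) → supportSize (d +v e) ≤ supportSize d + supportSize e
supportSize-+v []          []          = z≤n
supportSize-+v (zero  ∷ d) (zero  ∷ e) = supportSize-+v d e
supportSize-+v (zero  ∷ d) (suc _ ∷ e) =
  ≤-trans (s≤s (supportSize-+v d e)) (≤-reflexive (sym (+-suc (supportSize d) (supportSize e))))
supportSize-+v (suc _ ∷ d) (y     ∷ e) =
  s≤s (≤-trans (supportSize-+v d e) (+-monoʳ-≤ (supportSize d) (m≤n+m (supportSize e) (indicator y))))

module _ (a b : WC n) where

  slidePairs : List (WC n × WC n)
  slidePairs = concatMap (λ d → map (d ,_) (slide b)) (slide a)

  candidatesOf : QSSElem → List (WC n)
  candidatesOf (_ , γa , γb) = candidates a b γa γb

  taggedCandidates : List (QSSElem × WC n)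
  taggedCandidates = concatMap (λ q → map (q ,_) (candidatesOf q)) (QSS a b)

  split : WC n × WC n → QSSElem × WC n
  split (d , e) = (supportSize (d +v e) , restrict d (d +v e) , restrict e (d +v e)) , d +v e

  split-injective : ∀ {p p′} → split p ≡ split p′ → p ≡ p′
  split-injective {d , e} {d′ , e′} eq = cong₂ _,_
    (trans (sym (fill-restrict-+vˡ d e)) (trans (cong₂ fill c≡c′ γa≡γa′) (fill-restrict-+vˡ d′ e′)))
    (trans (sym (fill-restrict-+vʳ d e)) (trans (cong₂ fill c≡c′ γb≡γb′) (fill-restrict-+vʳ d′ e′)))
    where
    c≡c′ = cong proj₂ eq
    γa≡γa′ = cong (λ q → toList (proj₁ (proj₂ (proj₁ q)))) eq
    γb≡γb′ = cong (λ q → toList (proj₂ (proj₂ (proj₁ q)))) eq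

  restrict-fill-pair : (c : WC n) {ℓ : ℕ} (γa γb : WC ℓ) → supportSize c ≡ ℓ →
    _≡_ {A = QSSElem × WC n} ((supportSize c , restrict (fill c (toList γa)) c , restrict (fill c (toList γb)) c) , c)
                             ((ℓ , γa , γb) , c)
  restrict-fill-pair c γa γb refl = cong₂ (λ γa′ γb′ → (supportSize c , γa′ , γb′) , c) (restrict-fill c γa) (restrict-fill c γb)

  split-along : ∀ {d e c} → d +v e ≡ c → split (d , e) ≡ ((supportSize c , restrict d c , restrict e c) , c)
  split-along refl = refl

  split-∈ : ∀ {d e} → d ∈ slide a → e ∈ slide b → split (d , e) ∈ taggedCandidates
  split-∈ {d} {e} d∈ e∈ =
    ∈-concatMap⁺′ (λ q → map (q ,_) (candidatesOf q)) (∈-map⁺ (_ ,_) c∈) (∈-QSS⁺ a b size≤ inQSS)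
    where
    c = d +v e
    d-flat = proj₁ (∈-slide⁻ d∈)
    e-flat = proj₁ (∈-slide⁻ e∈)
    sum≡ : toList (restrict d c +v restrict e c) ≡ flat c
    sum≡ = trans (cong toList (sym (restrict-+v d e c))) (restrict-self c)
    c∈ : c ∈ candidates a b (restrict d c) (restrict e c)
    c∈ = ∈-candidates⁺ (sym sum≡ , subst (_⊵ a) (sym (fill-restrict-+vˡ d e)) (proj₂ (∈-slide⁻ d∈))
                                  , subst (_⊵ b) (sym (fill-restrict-+vʳ d e)) (proj₂ (∈-slide⁻ e∈)))
    inQSS : InQSS a b (restrict d c) (restrict e c)
    inQSS = trans (sym (flat-fill-supportSize c _)) (trans (cong flat (fill-restrict-+vˡ d e)) d-flat)
          , trans (sym (flat-fill-supportSize c _)) (trans (cong flat (fill-restrict-+vʳ d e)) e-flat)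
          , subst Positive (sym sum≡) (flat-positive c)
          , Data.List.Relation.Unary.Any.map (λ _ → tt) c∈
    size≤ : supportSize c ≤ length (flat a) + length (flat b)
    size≤ = ≤-trans (supportSize-+v d e)
      (+-mono-≤ (≤-reflexive (supportSize≡length-flat {c = d} d-flat)) (≤-reflexive (supportSize≡length-flat {c = e} e-flat)))

  split-complete : ∀ {ℓ} {γa γb : WC ℓ} {c} → (ℓ , γa , γb) ∈ QSS a b → c ∈ candidates a b γa γb →
                   ((ℓ , γa , γb) , c) ∈ map split slidePairs
  split-complete {ℓ} {γa} {γb} {c} q∈ c∈ = subst (_∈ map split slidePairs) split≡ (∈-map⁺ split pair∈)
    where
    c-flat = proj₁ (∈-candidates⁻ c∈)
    inQSS = ∈-QSS⁻ a b q∈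
    d = fill c (toList γa)
    e = fill c (toList γb)
    size≡ℓ : supportSize c ≡ ℓ
    size≡ℓ = trans (supportSize≡length-flat {c = c} c-flat) (length-toList (γa +v γb))
    pair∈ : (d , e) ∈ slidePairs
    pair∈ = ∈-concatMap⁺′ (λ d → map (d ,_) (slide b))
      (∈-map⁺ (d ,_) (∈-slide⁺ (trans (flat-fill c (toList γb) (trans size≡ℓ (sym (length-toList γb))))
                                       (proj₁ (proj₂ inQSS)))
                               (proj₂ (proj₂ (∈-candidates⁻ c∈)))))
      (∈-slide⁺ (trans (flat-fill c (toList γa) (trans size≡ℓ (sym (length-toList γa)))) (proj₁ inQSS))
                (proj₁ (proj₂ (∈-candidates⁻ c∈))))
    d+e≡c : d +v e ≡ c
    d+e≡c = trans (sym (fill-+v c γa γb)) (trans (cong (fill c) (sym c-flat)) (fill-flat c))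
    split≡ : split (d , e) ≡ ((ℓ , γa , γb) , c)
    split≡ = trans (split-along d+e≡c) (restrict-fill-pair c γa γb size≡ℓ)

  Unique-slidePairs : Unique slidePairs
  Unique-slidePairs = Unique-concatMap⁺ proj₁ id (λ d → map (d ,_) (slide b)) (slide a)
    (subst Unique (sym (List.map-id (slide a))) (Unique-slide a))
    (λ d → Unique.map⁺ ,-injectiveʳ (Unique-slide b))
    (λ d p∈ → let _ , _ , p≡ = ∈-map⁻ (d ,_) p∈ in cong proj₁ p≡)

  Unique-taggedCandidates : Unique taggedCandidates
  Unique-taggedCandidates = Unique-concatMap⁺ proj₁ id (λ q → map (q ,_) (candidatesOf q)) (QSS a b)
    (subst Unique (sym (List.map-id (QSS a b))) (Unique-QSS a b))
    (λ { q@(_ , γa , γb) → Unique.map⁺ ,-injectiveʳ (Unique-candidates a b γa γb) })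
    (λ q p∈ → let _ , _ , p≡ = ∈-map⁻ (q ,_) p∈ in cong proj₁ p≡)

  ∈-slidePairs⁻ : ∀ {p} → p ∈ slidePairs → proj₁ p ∈ slide a × proj₂ p ∈ slide b
  ∈-slidePairs⁻ p∈ =
    let d , d∈ , e∈′ = ∈-concatMap⁻′ (λ d → map (d ,_) (slide b)) (slide a) p∈
        e , e∈ , p≡  = ∈-map⁻ (d ,_) e∈′
    in subst (λ p → proj₁ p ∈ slide a × proj₂ p ∈ slide b) (sym p≡) (d∈ , e∈)

  map-split↭taggedCandidates : map split slidePairs ↭ taggedCandidates
  map-split↭taggedCandidates = ∼bag⇒↭ (unique∧set⇒bag
    (Unique.map⁺ split-injective Unique-slidePairs) Unique-taggedCandidates (mk⇔ to from))
    where
    to : ∀ {p} → p ∈ map split slidePairs → p ∈ taggedCandidates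
    to p∈ = let pair , pair∈ , p≡ = ∈-map⁻ split p∈
                d∈ , e∈ = ∈-slidePairs⁻ pair∈
            in subst (_∈ taggedCandidates) (sym p≡) (split-∈ d∈ e∈)
    from : ∀ {p} → p ∈ taggedCandidates → p ∈ map split slidePairs
    from p∈ = let q , q∈ , c∈′ = ∈-concatMap⁻′ (λ q → map (q ,_) (candidatesOf q)) (QSS a b) p∈
                  c , c∈ , p≡  = ∈-map⁻ (q ,_) c∈′
              in subst (_∈ map split slidePairs) (sym p≡) (split-complete q∈ c∈)

  slideProduct≡map-proj₂-split : slideProduct a b ≡ map proj₂ (map split slidePairs)
  slideProduct≡map-proj₂-split = sym (begin
    map proj₂ (map split slidePairs)
      ≡⟨ List.map-∘ slidePairs ⟨
    map (proj₂ ∘ split) slidePairs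
      ≡⟨ List.map-concatMap (proj₂ ∘ split) (λ d → map (d ,_) (slide b)) (slide a) ⟩
    concatMap (λ d → map (proj₂ ∘ split) (map (d ,_) (slide b))) (slide a)
      ≡⟨ List.concatMap-cong (λ d → List.map-∘ (slide b)) (slide a) ⟨
    slideProduct a b ∎)
    where open ≡-Reasoning

  map-proj₂-taggedCandidates : map proj₂ taggedCandidates ≡ concatMap candidatesOf (QSS a b)
  map-proj₂-taggedCandidates = begin
    map proj₂ taggedCandidates
      ≡⟨ List.map-concatMap proj₂ (λ q → map (q ,_) (candidatesOf q)) (QSS a b) ⟩
    concatMap (λ q → map proj₂ (map (q ,_) (candidatesOf q))) (QSS a b)
      ≡⟨ List.concatMap-cong (λ q → trans (sym (List.map-∘ (candidatesOf q))) (List.map-id (candidatesOf q))) (QSS a b) ⟩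
    concatMap candidatesOf (QSS a b) ∎
    where open ≡-Reasoning

  concatMap-candidates≡slideSum : concatMap candidatesOf (QSS a b) ≡ slideSum (quasiSlide a b)
  concatMap-candidates≡slideSum = sym (begin
    slideSum (quasiSlide a b)
      ≡⟨ concatMap-concatMap slide _ (QSS a b) ⟩
    concatMap (λ { (_ , γa , γb) → concatMap slide (bumps a b γa γb) }) (QSS a b)
      ≡⟨ concatMap-cong-∈ _ candidatesOf (QSS a b) (λ q q∈ → slide-bumps≡candidates (∈-QSS⁻ a b q∈)) ⟩
    concatMap candidatesOf (QSS a b) ∎)
    where open ≡-Reasoning

theorem5p5 : (n : ℕ) (a b : WC n) → slideProduct a b ↭ slideSum (quasiSlide a b)
theorem5p5 n a b = begin
  slideProduct a b                             ≡⟨ slideProduct≡map-proj₂-split a b ⟩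
  map proj₂ (map (split a b) (slidePairs a b)) ↭⟨ Permutation.map⁺ proj₂ (map-split↭taggedCandidates a b) ⟩
  map proj₂ (taggedCandidates a b)             ≡⟨ map-proj₂-taggedCandidates a b ⟩
  concatMap (candidatesOf a b) (QSS a b)       ≡⟨ concatMap-candidates≡slideSum a b ⟩
  slideSum (quasiSlide a b)                    ∎
  where open PermutationReasoning
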